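{- Let $\mathbf{G}\supset\mathbf{B}\supset\mathbf{T}$ be a quasisplit reductive group over $S$ with Borel subgroup and maximally split maximal torus, and let $\tilde{\mathbf{G}}$ and $\tilde{\mathbf{G}}_0$ be two degree $n$ covers of $\mathbf{G}$ with first Brylinski–Deligne invariants $Q$ and $Q_0$ respectively. If $Q(y)-Q_0(y)\in n\mathbb{Z}$ for all $y\in\mathscr{Y}$, then the modified dual root data coincide, $\tilde\Psi^\vee=\tilde\Psi_0^\vee$, and hence the dual groups are equal: $\tilde{\mathbb{G}}^\vee=\tilde{\mathbb{G}}_0^\vee$.
   Context: $S$ is $\operatorname{Spec}$ of a field or of a DVR (containing a field or with finite residue field). A degree $n$ cover of $\mathbf{G}$ is a pair $(\mathbf{G}',n)$ with $\mathbf{G}'$ a central extension of $\mathbf{G}$ by $\mathbf{K}_2$ on the big Zariski site (Brylinski–Deligne), such that all residue fields of $S$ have exactly $n$ $n$-th roots of unity; its first Brylinski–Deligne invariant is a Galois- and Weyl-invariant quadratic form $Q:\mathscr{Y}\to\mathbb{Z}$ on the étale local system $\mathscr{Y}$ of cocharacters of $\mathbf{T}$ ($\mathscr{X}$ denotes characters, $\Phi,\Phi^\vee$ roots and coroots, $\Delta,\Delta^\vee$ simple ones for $\mathbf{B}$). Let $\beta_Q(y_1,y_2)=n^{ -1}(Q(y_1+y_2)-Q(y_1)-Q(y_2))$, $\mathscr{Y}_{Q,n}=\{y\in\mathscr{Y}:\beta_Q(y,y')\in\mathbb{Z}\ \forall y'\}$, $\mathscr{X}_{Q,n}=\{x\in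 n^{ -1}\mathscr{X}:\langle x,y\rangle\in\mathbb{Z}\ \forall y\in\mathscr{Y}_{Q,n}\}$. For $\phi\in\Phi$ put $n_\phi=n/\gcd(n,Q(\phi^\vee))$, $\tilde\phi=n_\phi^{ -1}\phi$, $\tilde\phi^\vee=n_\phi\phi^\vee$; let $\tilde\Phi,\tilde\Phi^\vee,\tilde\Delta,\tilde\Delta^\vee$ be the sets of modified (simple) roots and coroots. The modified dual root datum is the local system of based root data $\tilde\Psi^\vee=(\mathscr{Y}_{Q,n},\tilde\Phi^\vee,\tilde\Delta^\vee,\mathscr{X}_{Q,n},\tilde\Phi,\tilde\Delta)$, and the dual group $\tilde{\mathbb{G}}^\vee$ is the local system on $S_{\mathrm{et}}$ of pinned reductive group schemes over $\mathbb{Z}$ attached to it (unique up to unique isomorphism). -}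

module Defs where

open import Data.Nat as ℕ using (ℕ; NonZero; ≢-nonZero; ≢-nonZero⁻¹)
open import Data.Nat.GCD using (gcd; gcd[m,n]≢0)
open import Data.Nat.DivMod using (_/_)
open import Data.Integer as ℤ using (ℤ; +_; _+_; _-_; _*_; ∣_∣)
open import Data.Integer.Divisibility using (_∣_)
open import Data.Fin using (Fin; zero; suc)
open import Data.Bool using (Bool)
open import Data.Sum using (inj₁)
open import Data.Product using (_×_; Σ)
open import Function.Bundles using (_⇔_)
open import Relation.Binary.PropositionalEquality using (_≡_)

-- Lattices of rank r: ℤ^r, realised as functions Fin r → ℤ.
-- Characters X and cocharacters Y of T are both Lat r, paired by
-- the standard perfect pairing.

Lat : ℕ → Set
Lat r = Fin r → ℤ

sumFin : ∀ {r} → (Fin r → ℤ) → ℤ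
sumFin {ℕ.zero}  f = + 0
sumFin {ℕ.suc r} f = f zero + sumFin (λ i → f (suc i))

⟨_,_⟩ : ∀ {r} → Lat r → Lat r → ℤ
⟨ x , y ⟩ = sumFin (λ i → x i * y i)

_⊕_ : ∀ {r} → Lat r → Lat r → Lat r
(x ⊕ y) i = x i + y i

_⊖_ : ∀ {r} → Lat r → Lat r → Lat r
(x ⊖ y) i = x i - y i

_·_ : ∀ {r} → ℤ → Lat r → Lat r
(k · x) i = k * x i

-- A (reduced) root datum of rank r with a chosen base, roots indexed by Fin m.
-- root i ∈ X, coroot i ∈ Y, ⟨root i , coroot i⟩ = 2, and Φ, Φ^∨ stable under
-- the reflections s_i(x) = x - ⟨x,α_i^∨⟩α_i, s_i^∨(y) = y - ⟨α_i,y⟩α_i^∨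
-- (compatibly with the bijection root ↔ coroot).  simple i marks Δ.

record RootDatum (r m : ℕ) : Set where
  field
    root    : Fin m → Lat r
    coroot  : Fin m → Lat r
    simple  : Fin m → Bool
    pair-2  : ∀ i → ⟨ root i , coroot i ⟩ ≡ + 2
    refl-closed : ∀ i j → Σ (Fin m) λ k →
      (root k ≡ (root j ⊖ (⟨ root j , coroot i ⟩ · root i))) ×
      (coroot k ≡ (coroot j ⊖ (⟨ root i , coroot j ⟩ · coroot i)))

  sᵛ : Fin m → Lat r → Lat r
  sᵛ i y = y ⊖ (⟨ root i , y ⟩ · coroot i)

-- ℤ-valued quadratic forms on Y = ℤ^r: Q(k y) = k² Q(y) and the polar form
-- B(y₁,y₂) = Q(y₁+y₂) - Q(y₁) - Q(y₂) is bilinear (it is symmetric by definition).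

polar : ∀ {r} → (Lat r → ℤ) → Lat r → Lat r → ℤ
polar Q y₁ y₂ = Q (y₁ ⊕ y₂) - Q y₁ - Q y₂

record IsQuadraticForm {r} (Q : Lat r → ℤ) : Set where
  field
    homog    : ∀ k y → Q (k · y) ≡ k * k * Q y
    polar-+  : ∀ y₁ y₂ y → polar Q (y₁ ⊕ y₂) y ≡ polar Q y₁ y + polar Q y₂ y
    polar-·  : ∀ k y₁ y → polar Q (k · y₁) y ≡ k * polar Q y₁ y

record WeylInvQuadForm {r m} (Ψ : RootDatum r m) (Q : Lat r → ℤ) : Set where
  field
    quadratic : IsQuadraticForm Q
    weyl-inv  : ∀ i y → Q (RootDatum.sᵛ Ψ i y) ≡ Q y

-- The modified dual root datum attached to (Q, n).
-- β_Q(y₁,y₂) = n⁻¹ polar Q y₁ y₂, so "β_Q(y,y') ∈ ℤ" means n ∣ polar Q y y'.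

Y-Qn : ∀ {r} → (Lat r → ℤ) → ℕ → Lat r → Set
Y-Qn Q n y = ∀ y′ → (+ n) ∣ polar Q y y′

-- An element of n⁻¹X is written x′/n with x′ ∈ X; X-Qn Q n x′ says x′/n ∈ X_{Q,n},
-- i.e. ⟨x′/n , y⟩ ∈ ℤ for all y ∈ Y_{Q,n}.
X-Qn : ∀ {r} → (Lat r → ℤ) → ℕ → Lat r → Set
X-Qn Q n x′ = ∀ y → Y-Qn Q n y → (+ n) ∣ ⟨ x′ , y ⟩

-- gcd(n, Q(φ^∨)) (the gcd is taken of |Q(φ^∨)|, which is the same thing)
gcdQ : ∀ {r} → (Lat r → ℤ) → ℕ → Lat r → ℕ
gcdQ Q n φᵛ = gcd n ∣ Q φᵛ ∣

n-φ : ∀ {r} → (Lat r → ℤ) → (n : ℕ) → .{{NonZero n}} → Lat r → ℕ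
n-φ Q n {{nz}} φᵛ =
  _/_ n (gcd n ∣ Q φᵛ ∣)
    {{≢-nonZero (gcd[m,n]≢0 n ∣ Q φᵛ ∣ (inj₁ (≢-nonZero⁻¹ n {{nz}})))}}

module ModifiedDual {r m} (Ψ : RootDatum r m) (Q : Lat r → ℤ)
                    (n : ℕ) .{{_ : NonZero n}} where
  open RootDatum Ψ
  -- modified root φ̃ = n_φ⁻¹ φ ∈ n⁻¹X, written as x′/n with x′ = (n / n_φ)·φ
  -- = gcd(n,Q(φ^∨))·φ
  modRoot : Fin m → Lat r
  modRoot i = (+ gcdQ Q n (coroot i)) · root i
  modCoroot : Fin m → Lat r
  modCoroot i = (+ n-φ Q n (coroot i)) · coroot i

-- Equality of the modified dual root data Ψ̃^∨ = (Y_{Q,n}, Φ̃^∨, Δ̃^∨, X_{Q,n}, Φ̃, Δ̃)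
-- for Q and Q₀: same sublattices (as subsets), and the same modified (co)roots,
-- root by root (Δ̃, Δ̃^∨ are the images of the same simple indices).
SameModifiedDual : ∀ {r m} (Ψ : RootDatum r m) (Q Q₀ : Lat r → ℤ)
                   (n : ℕ) .{{_ : NonZero n}} → Set
SameModifiedDual Ψ Q Q₀ n =
  (∀ y → Y-Qn Q n y ⇔ Y-Qn Q₀ n y) ×
  (∀ x′ → X-Qn Q n x′ ⇔ X-Qn Q₀ n x′) ×
  (∀ i → modRoot i ≡ modRoot₀ i) ×
  (∀ i → modCoroot i ≡ modCoroot₀ i)
  where
    open ModifiedDual Ψ Q n
    open ModifiedDual Ψ Q₀ n renaming (modRoot to modRoot₀; modCoroot to modCoroot₀)

module Submission where

-- Every ingredient of the modified dual root datum only sees Q modulo n: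
--   * Y_{Q,n} is cut out by "n divides polar Q y y′", and the polar form of Q
--     is a ℤ-linear combination of values of Q, so it is congruent modulo n to
--     the polar form of Q₀;
--   * X_{Q,n} is the dual of Y_{Q,n}, hence determined by it;
--   * the modified roots and coroots depend on Q only through the integers
--     gcd(n, Q(φ^∨)), and gcd(n, a) only depends on a modulo n.

open import Defs
open import Data.Nat using (ℕ; NonZero)
open import Data.Integer using (ℤ; +_; _-_)
open import Data.Integer.Divisibility using (_∣_)

open import Data.Integer using (-_; ∣_∣)
import Data.Integer.Divisibility.Signed as Signed
open import Data.Integer.Tactic.RingSolver using (solve-∀)
import Data.Nat.Divisibility as ℕ
open import Data.Nat.DivMod using (/-congʳ)
open import Data.Nat.GCD using (gcd; gcd[m,n]∣m; gcd[m,n]∣n; gcd-greatest)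
open import Data.Product using (_,_)
open import Function.Bundles using (_⇔_; mk⇔; module Equivalence)
open import Relation.Binary.PropositionalEquality using (_≡_; cong; subst)

-- a ≡ b (mod n), phrased with signed divisibility, which has the better
-- algebraic API; the unsigned form of the theorem converts via ∣ᵤ⇒∣ / ∣⇒∣ᵤ.
-- A record rather than a bare divisibility, so that a and b can be inferred.
record Congruent (n : ℕ) (a b : ℤ) : Set where
  constructor congruent
  field n∣a-b : + n Signed.∣ (a - b)

congruent-sym : ∀ {n a b} → Congruent n a b → Congruent n b a
congruent-sym {n} {a} {b} (congruent n∣a-b) =
  congruent (subst (+ n Signed.∣_) (negate-difference a b) (Signed.∣m⇒∣-m n∣a-b))
  where
  negate-difference : ∀ a b → - (a - b) ≡ b - a
  negate-difference = solve-∀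

congruent-sub : ∀ {n a a′ b b′} → Congruent n a a′ → Congruent n b b′ →
                Congruent n (a - b) (a′ - b′)
congruent-sub {n} {a} {a′} {b} {b′} (congruent n∣a-a′) (congruent n∣b-b′) =
  congruent (subst (+ n Signed.∣_) (regroup a a′ b b′) (Signed.∣m∣n⇒∣m-n n∣a-a′ n∣b-b′))
  where
  regroup : ∀ a a′ b b′ → (a - a′) - (b - b′) ≡ (a - b) - (a′ - b′)
  regroup = solve-∀

∣-respects-congruent : ∀ {d n a b} → d Signed.∣ + n → Congruent n a b →
                       d Signed.∣ a → d Signed.∣ b
∣-respects-congruent {d} {n} {a} {b} d∣n (congruent n∣a-b) d∣a =
  subst (d Signed.∣_) (difference-of-difference a b)
    (Signed.∣m∣n⇒∣m-n d∣a (Signed.∣-trans d∣n n∣a-b))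
  where
  difference-of-difference : ∀ a b → a - (a - b) ≡ b
  difference-of-difference = solve-∀

-- gcd(n, |a|) only depends on a modulo n: it divides n and a, hence b.
gcd-∣-congruent : ∀ {n a b} → Congruent n a b → gcd n ∣ a ∣ ℕ.∣ gcd n ∣ b ∣
gcd-∣-congruent {n} {a} {b} a≡b = gcd-greatest (gcd[m,n]∣m n ∣ a ∣)
  (Signed.∣⇒∣ᵤ {i = b} (∣-respects-congruent g∣n a≡b g∣a))
  where
  g∣n : + gcd n ∣ a ∣ Signed.∣ + n
  g∣n = Signed.∣ᵤ⇒∣ (gcd[m,n]∣m n ∣ a ∣)
  g∣a : + gcd n ∣ a ∣ Signed.∣ a
  g∣a = Signed.∣ᵤ⇒∣ {i = a} (gcd[m,n]∣n n ∣ a ∣)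

gcd-congruent : ∀ {n a b} → Congruent n a b → gcd n ∣ a ∣ ≡ gcd n ∣ b ∣
gcd-congruent a≡b = ℕ.∣-antisym (gcd-∣-congruent a≡b) (gcd-∣-congruent (congruent-sym a≡b))

CongruentForms : ∀ {r} → ℕ → (Lat r → ℤ) → (Lat r → ℤ) → Set
CongruentForms n Q Q₀ = ∀ y → Congruent n (Q y) (Q₀ y)

congruentForms-sym : ∀ {r n} {Q Q₀ : Lat r → ℤ} →
                     CongruentForms n Q Q₀ → CongruentForms n Q₀ Q
congruentForms-sym Q≡Q₀ y = congruent-sym (Q≡Q₀ y)

-- The polar form is a combination of values, so it respects the congruence.
polar-congruent : ∀ {r n} {Q Q₀ : Lat r → ℤ} → CongruentForms n Q Q₀ →
                  ∀ y y′ → Congruent n (polar Q y y′) (polar Q₀ y y′)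
polar-congruent Q≡Q₀ y y′ =
  congruent-sub (congruent-sub (Q≡Q₀ (y ⊕ y′)) (Q≡Q₀ y)) (Q≡Q₀ y′)

Y-Qn-congruent : ∀ {r n} {Q Q₀ : Lat r → ℤ} → CongruentForms n Q Q₀ →
                 ∀ y → Y-Qn Q n y → Y-Qn Q₀ n y
Y-Qn-congruent {Q = Q} {Q₀} Q≡Q₀ y y∈Y y′ =
  Signed.∣⇒∣ᵤ {i = polar Q₀ y y′}
    (∣-respects-congruent Signed.∣-refl (polar-congruent Q≡Q₀ y y′)
                          (Signed.∣ᵤ⇒∣ {i = polar Q y y′} (y∈Y y′)))

X-Qn-antitone : ∀ {r n} {Q Q₀ : Lat r → ℤ} → (∀ y → Y-Qn Q₀ n y → Y-Qn Q n y) →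
                ∀ x′ → X-Qn Q n x′ → X-Qn Q₀ n x′
X-Qn-antitone Y₀⊆Y x′ x′∈X y y∈Y₀ = x′∈X y (Y₀⊆Y y y∈Y₀)

gcdQ-congruent : ∀ {r n} {Q Q₀ : Lat r → ℤ} → CongruentForms n Q Q₀ →
                 ∀ φᵛ → gcdQ Q n φᵛ ≡ gcdQ Q₀ n φᵛ
gcdQ-congruent Q≡Q₀ φᵛ = gcd-congruent (Q≡Q₀ φᵛ)

n-φ-congruent : ∀ {r n} .{{_ : NonZero n}} {Q Q₀ : Lat r → ℤ} →
                CongruentForms n Q Q₀ → ∀ φᵛ → n-φ Q n φᵛ ≡ n-φ Q₀ n φᵛ
n-φ-congruent Q≡Q₀ φᵛ = /-congʳ ⦃ _ ⦄ ⦃ _ ⦄ (gcdQ-congruent Q≡Q₀ φᵛ)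

proposition2p1 : ∀ {r m} (Ψ : RootDatum r m) (n : ℕ) .{{_ : NonZero n}}
    (Q Q₀ : Lat r → ℤ) → WeylInvQuadForm Ψ Q → WeylInvQuadForm Ψ Q₀ →
    (∀ y → (+ n) ∣ (Q y - Q₀ y)) →
    SameModifiedDual Ψ Q Q₀ n
proposition2p1 Ψ n Q Q₀ _ _ n∣Q-Q₀ = sameY , sameX , sameRoot , sameCoroot
  where
  open RootDatum Ψ

  Q≡Q₀ : CongruentForms n Q Q₀
  Q≡Q₀ y = congruent (Signed.∣ᵤ⇒∣ (n∣Q-Q₀ y))

  sameY : ∀ y → Y-Qn Q n y ⇔ Y-Qn Q₀ n y
  sameY y = mk⇔ (Y-Qn-congruent Q≡Q₀ y) (Y-Qn-congruent (congruentForms-sym Q≡Q₀) y)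

  sameX : ∀ x′ → X-Qn Q n x′ ⇔ X-Qn Q₀ n x′
  sameX x′ = mk⇔ (X-Qn-antitone {Q = Q} {Q₀} (λ y → Equivalence.from (sameY y)) x′)
                 (X-Qn-antitone {Q = Q₀} {Q} (λ y → Equivalence.to (sameY y)) x′)

  sameRoot : ∀ i → (+ gcdQ Q n (coroot i)) · root i ≡ (+ gcdQ Q₀ n (coroot i)) · root i
  sameRoot i = cong (λ k → (+ k) · root i) (gcdQ-congruent Q≡Q₀ (coroot i))

  sameCoroot : ∀ i → (+ n-φ Q n (coroot i)) · coroot i ≡ (+ n-φ Q₀ n (coroot i)) · coroot i
  sameCoroot i = cong (λ k → (+ k) · coroot i) (n-φ-congruent Q≡Q₀ (coroot i))
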